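{- Let $G=(V,E)$ be a finite simple undirected graph in which every node has even degree, and run algorithm Euler-Tour on a stream of its edges. Let $C_1,\ldots,C_N$ be the cycles passed to Merge-Cycle, in chronological order, and define $R^*(E)$ and $\delta^c$ as in the context. Then $\delta^c$ is bijective, and for any $e,e'\in R^*(E)$ we have $e\equiv_{\delta^c}e'$ if and only if there is $i\in[N]$ with $e,e'\in E(C_i)$.
   Context: Setting: $G=(V,E)$ is a finite simple undirected graph, streamed edge by edge, each edge read once in arbitrary order. Algorithm Euler-Tour. Initialize $c:=0$, $F:=\emptyset$ (a set of directed edges), $E_{\mathrm{int}}:=\emptyset$, and $j(v):=0$, $t(v):=0$ for all $v\in V$. Output consists of triples $(v_1,v_2,s)$. Main loop: for each streamed edge $e$, add it to $E_{\mathrm{int}}$. If $(V,E_{\mathrm{int}})$ contains a cycle $C$, call Merge-Cycle$(C)$ with $C$ given as an ordered cycle $(v_1,\ldots,v_k)$, indices cyclic. Merge-Cycle performs the following steps in order. 1. For $i=1,\ldots,k$: if $t(v_i)=0$, set $j(v_i):=v_{i+1}$ and add $(v_{i-1},v_i)$ to $F$. 2. Set $M:=\emptyset$ and $J:=\emptyset$. For each $j=1,\ldots,|V|$: if some $v_i$ has $t(v_i)=j$, add exactly one such $v_i$ to $J$ and add $j$ to $M$. 3. For each $v_i\in J$: write $(v_{i-1},v_i,j(v_i))$, then set $j(v_i):=v_{i+1}$. 4. For each edge $(v_i,v_{i+1})$ of $C$ that has been neither written nor added to $F$: write $(v_i,v_{i+1},v_{i+2})$. 5. If $M=\emptyset$,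 set $c:=c+1$ and $a:=c$; otherwise set $a:=\min M$. For each $v$ with $t(v)\in M$, set $t(v):=a$. For all $i$, set $t(v_i):=a$. 6. Delete the edges of $C$ from $E_{\mathrm{int}}$. At the end, for each $(u,v)\in F$, the triple $(u,v,j(v))$ is written (after error checks that $E_{\mathrm{int}}\ne\emptyset$ or that two nonzero $t$-values differ). Definitions used in the claim: - $R^*(E)$ is the set of directed edges $(u,v)$ for which some triple $(u,v,s)$ was written. When all degrees are even, this contains exactly one orientation of each edge. - For $C_i=(v^{(i)}_1,\ldots,v^{(i)}_{\ell_i})$, $E(C_i)$ is the set of its directed edges $(v^{(i)}_j,v^{(i)}_{j+1})$. - $\delta^c:R^*(E)\to R^*(E)$ is defined by $\delta^c((v^{(i)}_j,v^{(i)}_{j+1}))=(v^{(i)}_{j+1},v^{(i)}_{j+2})$, indices cyclic in $C_i$. A successor function $\delta$ satisfies $\delta(x)_{(1)}=x_{(2)}$. The relation $x\equiv_\delta x'$ holds if and only if $\delta^k(x)=x'$ for some $k\in\mathbb{N}=\{1,2,\ldots\}$. -}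

module Defs where

open import Data.Nat using (ℕ; zero; suc; _⊓_; _≤_)
open import Data.Nat.Divisibility using (_∣_)
open import Data.Fin using (Fin; _≟_)
open import Data.Bool using (Bool; true; false; if_then_else_; not; _∨_)
open import Data.Maybe using (Maybe; just; nothing)
open import Data.Product using (_×_; _,_; proj₁; proj₂; Σ; ∃; ∃-syntax)
open import Data.Product.Properties using (≡-dec)
open import Data.Sum using (_⊎_)
open import Data.List using (List; []; _∷_; _++_; [_]; length; map; filter; zip; reverse; foldl; upTo; concatMap)
open import Data.Bool.ListAction using (any)
open import Data.List.Membership.Propositional using (_∈_)
open import Data.List.Relation.Unary.All using (All)
open import Data.List.Relation.Unary.Any using (Any)
open import Data.List.Relation.Unary.AllPairs using (AllPairs)
open import Data.List.Relation.Unary.Unique.Propositional using (Unique)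
open import Relation.Nullary using (¬_; does)
open import Relation.Binary.PropositionalEquality using (_≡_; _≢_)
open import Data.Nat using (_≡ᵇ_)

Edge : ℕ → Set
Edge n = Fin n × Fin n

swap : ∀ {n} → Edge n → Edge n
swap (u , v) = (v , u)

_≟E_ : ∀ {n} (e e' : Edge n) → Relation.Nullary.Dec (e ≡ e')
_≟E_ = ≡-dec _≟_ _≟_

memE : ∀ {n} → Edge n → List (Edge n) → Bool
memE e es = any (λ e' → does (e ≟E e')) es

memV : ∀ {n} → Fin n → List (Fin n) → Bool
memV v vs = any (λ w → does (v ≟ w)) vs

-- Graph hypotheses (the stream is the edge list, each edge once)

Loopless : ∀ {n} → List (Edge n) → Set
Loopless es = All (λ e → proj₁ e ≢ proj₂ e) es

NoMultiEdges : ∀ {n} → List (Edge n) → Set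
NoMultiEdges es = AllPairs (λ e e' → e ≢ e' × e ≢ swap e') es

degree : ∀ {n} → List (Edge n) → Fin n → ℕ
degree es v = length (filter (λ e → (v ≟ proj₁ e) Relation.Nullary.⊎-dec (v ≟ proj₂ e)) es)

AllDegreesEven : ∀ {n} → List (Edge n) → Set
AllDegreesEven {n} es = (v : Fin n) → 2 ∣ degree es v

-- Ordered cycles, given as a list of vertices (v₁ , … , v_k), cyclic indices

rotL : ∀ {A : Set} → List A → List A
rotL []       = []
rotL (x ∷ xs) = xs ++ [ x ]

rotR : ∀ {A : Set} → List A → List A
rotR xs = reverse (rotL (reverse xs))

cycEdges : ∀ {n} → List (Fin n) → List (Edge n)
cycEdges vs = zip vs (rotL vs)

-- positions (v_{i-1} , v_i , v_{i+1}), i = 1..k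
Pos : ℕ → Set
Pos n = Fin n × Fin n × Fin n

positions : ∀ {n} → List (Fin n) → List (Pos n)
positions vs = zip (rotR vs) (zip vs (rotL vs))

cur : ∀ {n} → Pos n → Fin n
cur (_ , v , _) = v

Adj : ∀ {n} → List (Edge n) → Fin n → Fin n → Set
Adj E u v = (u , v) ∈ E ⊎ (v , u) ∈ E

IsCycle : ∀ {n} → List (Edge n) → List (Fin n) → Set
IsCycle E vs = 3 ≤ length vs × Unique vs × All (λ e → Adj E (proj₁ e) (proj₂ e)) (cycEdges vs)

Triple : ℕ → Set
Triple n = Fin n × Fin n × Maybe (Fin n)

record State (n : ℕ) : Set where
  field
    c    : ℕ
    F    : List (Edge n)
    Eint : List (Edge n)
    j    : Fin n → Maybe (Fin n)   -- nothing encodes the initial value 0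
    t    : Fin n → ℕ
    out  : List (Triple n)
open State public

initState : ∀ {n} → State n
initState = record { c = 0 ; F = [] ; Eint = [] ; j = λ _ → nothing ; t = λ _ → 0 ; out = [] }

upd : ∀ {n} {A : Set} → (Fin n → A) → Fin n → A → Fin n → A
upd f v x w = if does (w ≟ v) then x else f w

pairOf : ∀ {n} → Triple n → Edge n
pairOf (a , b , _) = (a , b)

step1 : ∀ {n} → List (Pos n) → State n → State n
step1 P s = foldl go s P
  where
  go : _ → _ → _
  go s (p , v , q) with t s v ≡ᵇ 0
  ... | true  = record s { j = upd (j s) v (just q) ; F = F s ++ [ (p , v) ] }
  ... | false = s

Mset : ∀ {n} → (Fin n → ℕ) → List (Fin n) → List ℕ
Mset {n} tt vs = filter (λ m → Data.List.Relation.Unary.Any.any? (λ v → tt v Data.Nat.≟ m) vs) (map suc (upTo n))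

-- J (given as the positions of the chosen vertices) contains exactly one
-- cycle vertex of each value m ∈ M (in increasing order of m)
ValidJ : ∀ {n} → (Fin n → ℕ) → List (Fin n) → List (Pos n) → Set
ValidJ tt vs J = All (_∈ positions vs) J × map (λ x → tt (cur x)) J ≡ Mset tt vs

step3 : ∀ {n} → List (Pos n) → State n → State n
step3 J s = foldl go s J
  where
  go : _ → _ → _
  go s (p , v , q) = record s { out = out s ++ [ (p , v , j s v) ] ; j = upd (j s) v (just q) }

-- Step 4: for each edge (v_i, v_{i+1}) of C neither written nor in F,
-- write (v_i, v_{i+1}, v_{i+2}).  (Equivalently, over positions
-- (v_{i-1}, v_i, v_{i+1}) with the edge (v_{i-1}, v_i).)
step4 : ∀ {n} → List (Pos n) → State n → State n
step4 P s = foldl go s P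
  where
  go : _ → _ → _
  go s' (p , v , q) with memE (p , v) (map pairOf (out s')) ∨ memE (p , v) (F s')
  ... | true  = s'
  ... | false = record s' { out = out s' ++ [ (p , v , just q) ] }

minList : ℕ → List ℕ → ℕ
minList m []       = m
minList m (x ∷ xs) = minList (m ⊓ x) xs

step5 : ∀ {n} → List ℕ → List (Fin n) → State n → State n
step5 []      vs s = record s { c = suc (c s) ; t = λ w → if memV w vs then suc (c s) else t s w }
step5 (m ∷ M) vs s =
  let a = minList m M in
  record s { t = λ w → if memV w vs ∨ any (λ x → t s w ≡ᵇ x) (m ∷ M) then a else t s w }

step6 : ∀ {n} → List (Fin n) → State n → State n
step6 vs s = record s { Eint = filter (λ e → Data.Bool._≟_ (memE e (cycEdges vs) ∨ memE (swap e) (cycEdges vs)) false) (Eint s) }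

mergeCycle : ∀ {n} → List (Fin n) → List (Pos n) → State n → State n
mergeCycle vs J s =
  step6 vs (step5 (Mset (t s) vs) vs (step4 (positions vs) (step3 J (step1 (positions vs) s))))

-- The choice of the cycle (its orientation and
-- starting vertex) and of J in step 2 is nondeterministic.

addEdge : ∀ {n} → Edge n → State n → State n
addEdge e s = record s { Eint = Eint s ++ [ e ] }

data Exec {n : ℕ} : State n → List (Edge n) → List (List (Fin n)) → State n → Set where
  done    : ∀ {s} → Exec s [] [] s
  noCycle : ∀ {s e es Cs s'} →
            ¬ (∃[ vs ] IsCycle (Eint (addEdge e s)) vs) →
            Exec (addEdge e s) es Cs s' →
            Exec s (e ∷ es) Cs s'
  merge   : ∀ {s e es Cs s'} (vs : List (Fin n)) (J : List (Pos n)) →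
            IsCycle (Eint (addEdge e s)) vs →
            ValidJ (t s) vs J →
            Exec (mergeCycle vs J (addEdge e s)) es Cs s' →
            Exec s (e ∷ es) (vs ∷ Cs) s'

finalOutput : ∀ {n} → State n → List (Triple n)
finalOutput s = out s ++ map (λ e → (proj₁ e , proj₂ e , j s (proj₂ e))) (F s)

InRstar : ∀ {n} → State n → Edge n → Set
InRstar s e = e ∈ map pairOf (finalOutput s)

-- δᶜ : the successor of (v_j, v_{j+1}) in C_i is (v_{j+1}, v_{j+2}).
-- Realised as a total function on Edge n by looking the edge up in the
-- list of (edge, successor-edge) pairs of C₁,…,C_N (first occurrence);
-- outside the union of the E(C_i) it is the identity (irrelevant there).

succPairs : ∀ {n} → List (List (Fin n)) → List (Edge n × Edge n)
succPairs Cs = concatMap (λ vs → zip (cycEdges vs) (rotL (cycEdges vs))) Cs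

lookupSucc : ∀ {n} → List (Edge n × Edge n) → Edge n → Edge n
lookupSucc []              x = x
lookupSucc ((a , b) ∷ ps)  x = if does (x ≟E a) then b else lookupSucc ps x

deltaC : ∀ {n} → List (List (Fin n)) → Edge n → Edge n
deltaC Cs = lookupSucc (succPairs Cs)

iter : ∀ {A : Set} → (A → A) → ℕ → A → A
iter f zero    x = x
iter f (suc k) x = f (iter f k x)

EquivBy : ∀ {A : Set} → (A → A) → A → A → Set
EquivBy f x x' = ∃[ k ] iter f (suc k) x ≡ x'

-- Each step of Merge-Cycle(C) writes, or files in F for the final flush, only edges of C, and
-- step 4 writes every edge of C not recorded yet; so R*(E) is exactly the union of the E(C_i).
-- The C_i are edge-disjoint: the edges of a merged cycle leave E_int in both orientations at
-- step 6 and, as no edge is streamed twice, never re-enter it, whereas every edge of a later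
-- cycle lies in E_int.  Hence δᶜ, a table lookup keyed by the disjoint union of the E(C_i),
-- acts on each E(C_i) as the cyclic rotation: a bijection whose orbits are the E(C_i).

module Submission where

open import Defs
open import Data.Nat using (ℕ; zero; suc; _+_; _≡ᵇ_)
open import Data.Nat.Properties using (+-comm; +-suc; suc-injective)
open import Data.Fin using (Fin)
open import Data.Bool using (true; false; _∨_)
open import Data.Maybe using (just)
open import Data.Bool.Properties using (∨-conicalˡ; ∨-conicalʳ)
open import Data.List using (List; []; _∷_; _++_; [_]; _∷ʳ_; length; map; zip; reverse; concatMap; filter)
open import Data.List.Properties
  using (reverse-++; reverse-involutive; map-++; map-∘; map-id; map-concatMap; concatMap-cong; zip-map; ++-assoc; ++-identityʳ)
open import Data.List.Reverse using (reverseView; []; _∶_∶ʳ_)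
open import Data.List.Membership.Propositional using (_∈_; _∉_; lose; find)
open import Data.List.Membership.Propositional.Properties
  using (∈-map⁺; ∈-map⁻; ∈-++⁺ˡ; ∈-++⁺ʳ; ∈-++⁻; ∈-concatMap⁺; ∈-concatMap⁻; ∈-filter⁻)
open import Data.List.Relation.Unary.Any using (Any; here; there)
import Data.List.Relation.Unary.All as All
import Data.List.Relation.Unary.All.Properties as Allₚ
open import Data.List.Relation.Unary.All using (All; []; _∷_)
open import Data.List.Relation.Unary.AllPairs using ([]; _∷_)
import Data.List.Relation.Unary.AllPairs as AllPairs
open import Data.List.Relation.Unary.Unique.Propositional using (Unique)
import Data.List.Relation.Unary.Unique.Propositional.Properties as Unique
open import Data.List.Relation.Binary.Disjoint.Propositional using (Disjoint)
open import Data.List.Relation.Binary.Subset.Propositional using (_⊆_)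
open import Data.List.Relation.Binary.Subset.Propositional.Properties
  using (⊆-refl; ⊆-trans; ⊆-reflexive; ⊆-reflexive-↭; xs⊆xs++ys; xs⊆ys++xs; ++⁺ʳ; ++⁺ˡ; xs⊆x∷xs; ∈-∷⁺ʳ; map⁺; filter-⊆
        ; All-resp-⊇; module ⊆-Reasoning)
open import Data.List.Relation.Binary.Permutation.Propositional
  using (_↭_; ↭-sym; ↭-refl; ↭-trans; ↭-reflexive; ↭⇒↭ₛ; module PermutationReasoning)
open import Data.List.Relation.Binary.Permutation.Propositional.Properties
  renaming (++⁺ˡ to ++⁺ˡ↭) using (∷↭∷ʳ; ↭-length; ∈-resp-↭; ++⁺; shift; shifts; ↭-reverse)
import Data.List.Relation.Binary.Permutation.Setoid.Properties as PermutationSetoid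
open import Data.Product using (_×_; _,_; proj₁; proj₂; ∃-syntax; map₂)
open import Data.Sum using (inj₁; inj₂; [_,_]′)
open import Data.Empty using (⊥; ⊥-elim)
open import Function.Base using (_∘_; id)
open import Function.Bundles using (_⇔_; mk⇔; Equivalence)
open import Relation.Binary.Definitions using (_Respects_)
open import Relation.Binary.PropositionalEquality
  using (_≡_; _≢_; refl; sym; trans; cong; cong₂; subst; setoid; module ≡-Reasoning)
open import Relation.Nullary using (yes; no)

module _ {A : Set} where

  rotL-↭ : (xs : List A) → rotL xs ↭ xs
  rotL-↭ []       = ↭-refl
  rotL-↭ (x ∷ xs) = ↭-sym (∷↭∷ʳ x xs)

  length-rotL : (xs : List A) → length (rotL xs) ≡ length xs
  length-rotL xs = ↭-length (rotL-↭ xs)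

  length-rotR : (xs : List A) → length (rotR xs) ≡ length xs
  length-rotR xs = ↭-length (↭-trans (↭-reverse _) (↭-trans (rotL-↭ _) (↭-reverse xs)))

  rotL-rotR : (xs : List A) → rotL (rotR xs) ≡ xs
  rotL-rotR xs with reverseView xs
  ... | []          = refl
  ... | ys ∶ _ ∶ʳ y = begin
    rotL (reverse (rotL (reverse (ys ∷ʳ y))))  ≡⟨ cong (rotL ∘ reverse ∘ rotL) (reverse-++ ys [ y ]) ⟩
    rotL (reverse (reverse ys ∷ʳ y))           ≡⟨ cong rotL (reverse-++ (reverse ys) [ y ]) ⟩
    reverse (reverse ys) ∷ʳ y                  ≡⟨ cong (_∷ʳ y) (reverse-involutive ys) ⟩
    ys ∷ʳ y                                    ∎
    where open ≡-Reasoning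

  ∷ʳ-++-↭ : ∀ (xs : List A) x ys → (xs ∷ʳ x) ++ ys ↭ x ∷ xs ++ ys
  ∷ʳ-++-↭ xs x ys = ↭-trans (↭-reflexive (++-assoc xs [ x ] ys)) (shift x xs ys)

  ++-∷ʳ-↭ : ∀ (xs : List A) ys y → xs ++ (ys ∷ʳ y) ↭ y ∷ xs ++ ys
  ++-∷ʳ-↭ xs ys y = ↭-trans (++⁺ˡ↭ xs (↭-sym (∷↭∷ʳ y ys))) (shift y xs ys)

  concatMap-↭ : ∀ {B : Set} {f g : B → List A} → (∀ x → f x ↭ g x) → ∀ xs → concatMap f xs ↭ concatMap g xs
  concatMap-↭ f↭g []       = ↭-refl
  concatMap-↭ f↭g (x ∷ xs) = ++⁺ (f↭g x) (concatMap-↭ f↭g xs)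

  Unique-resp-↭ : Unique Respects _↭_
  Unique-resp-↭ p = PermutationSetoid.Unique-resp-↭ (setoid A) (↭⇒↭ₛ p)

  Unique-map-injective : ∀ {B : Set} {f : A → B} {xs x y} →
                         Unique (map f xs) → x ∈ xs → y ∈ xs → f x ≡ f y → x ≡ y
  Unique-map-injective (_ ∷ _)     (here refl) (here refl) _     = refl
  Unique-map-injective (fx∉ ∷ _)   (here refl) (there y∈)  fx≡fy = ⊥-elim (All.lookup fx∉ (∈-map⁺ _ y∈) fx≡fy)
  Unique-map-injective (fy∉ ∷ _)   (there x∈)  (here refl) fx≡fy = ⊥-elim (All.lookup fy∉ (∈-map⁺ _ x∈) (sym fx≡fy))
  Unique-map-injective (_ ∷ uniq)  (there x∈)  (there y∈)  fx≡fy = Unique-map-injective uniq x∈ y∈ fx≡fy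

  ++-⊆ : ∀ {xs ys zs : List A} → xs ⊆ zs → ys ⊆ zs → xs ++ ys ⊆ zs
  ++-⊆ {xs} xs⊆zs ys⊆zs v∈ with ∈-++⁻ xs v∈
  ... | inj₁ v∈xs = xs⊆zs v∈xs
  ... | inj₂ v∈ys = ys⊆zs v∈ys

  ++-∷-⊆ : ∀ {x : A} xs {ys zs} → ys ⊆ x ∷ zs → xs ++ ys ⊆ x ∷ xs ++ zs
  ++-∷-⊆ {x} xs {zs = zs} ys⊆ = ⊆-trans (++⁺ʳ xs ys⊆) (⊆-reflexive-↭ (shift x xs zs))

  ∷-++-⊆ : ∀ {x : A} xs {ys zs} → x ∷ zs ⊆ ys → x ∷ xs ++ zs ⊆ xs ++ ys
  ∷-++-⊆ {x} xs {zs = zs} ⊆ys = ⊆-trans (⊆-reflexive-↭ (↭-sym (shift x xs zs))) (++⁺ʳ xs ⊆ys)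

module _ {A B : Set} where

  map-proj₁-zip : ∀ (xs : List A) (ys : List B) → length xs ≡ length ys → map proj₁ (zip xs ys) ≡ xs
  map-proj₁-zip []       []       _  = refl
  map-proj₁-zip (x ∷ xs) (y ∷ ys) eq = cong (x ∷_) (map-proj₁-zip xs ys (suc-injective eq))

  map-proj₂-zip : ∀ (xs : List A) (ys : List B) → length xs ≡ length ys → map proj₂ (zip xs ys) ≡ ys
  map-proj₂-zip []       []       _  = refl
  map-proj₂-zip (x ∷ xs) (y ∷ ys) eq = cong (y ∷_) (map-proj₂-zip xs ys (suc-injective eq))

  zip-∷ʳ : ∀ (xs : List A) (ys : List B) {x y} → length xs ≡ length ys →
           zip (xs ∷ʳ x) (ys ∷ʳ y) ≡ zip xs ys ∷ʳ (x , y)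
  zip-∷ʳ []       []       _  = refl
  zip-∷ʳ (x ∷ xs) (y ∷ ys) eq = cong ((x , y) ∷_) (zip-∷ʳ xs ys (suc-injective eq))

  rotL-zip : ∀ (xs : List A) (ys : List B) → length xs ≡ length ys → rotL (zip xs ys) ≡ zip (rotL xs) (rotL ys)
  rotL-zip []       []       _  = refl
  rotL-zip (x ∷ xs) (y ∷ ys) eq = sym (zip-∷ʳ xs ys (suc-injective eq))

successorPairs : {A : Set} → List A → List (A × A)
successorPairs L = zip L (rotL L)

module _ {A : Set} (L : List A) where

  keys-successorPairs : map proj₁ (successorPairs L) ≡ L
  keys-successorPairs = map-proj₁-zip L (rotL L) (sym (length-rotL L))

  values-successorPairs : map proj₂ (successorPairs L) ≡ rotL L
  values-successorPairs = map-proj₂-zip L (rotL L) (sym (length-rotL L))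

module _ {A : Set} {L : List A} where

  ∈-successorPairs⁻ : ∀ {x y} → (x , y) ∈ successorPairs L → x ∈ L × y ∈ L
  ∈-successorPairs⁻ xy∈ =
    subst (_ ∈_) (keys-successorPairs L) (∈-map⁺ proj₁ xy∈) ,
    ∈-resp-↭ (rotL-↭ L) (subst (_ ∈_) (values-successorPairs L) (∈-map⁺ proj₂ xy∈))

  successor-exists : ∀ {x} → x ∈ L → ∃[ y ] (x , y) ∈ successorPairs L
  successor-exists x∈ with ∈-map⁻ proj₁ (subst (_ ∈_) (sym (keys-successorPairs L)) x∈)
  ... | (_ , y) , xy∈ , refl = y , xy∈

  predecessor-exists : ∀ {y} → y ∈ L → ∃[ x ] (x , y) ∈ successorPairs L
  predecessor-exists y∈ with ∈-map⁻ proj₂ (subst (_ ∈_) (sym (values-successorPairs L)) (∈-resp-↭ (↭-sym (rotL-↭ L)) y∈))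
  ... | (x , _) , xy∈ , refl = x , xy∈

module _ {A : Set} (f : A → A) where
  open ≡-Reasoning

  iter-+ : ∀ m k x → iter f (m + k) x ≡ iter f m (iter f k x)
  iter-+ zero    k x = refl
  iter-+ (suc m) k x = cong f (iter-+ m k x)

  iter-∷ : ∀ k {x y w} → f x ≡ y → iter f k y ≡ w → iter f (suc k) x ≡ w
  iter-∷ k {x} refl y⇝w = begin
    iter f (suc k) x  ≡⟨ cong (λ i → iter f i x) (+-comm 1 k) ⟩
    iter f (k + 1) x  ≡⟨ iter-+ k 1 x ⟩
    iter f k (f x)    ≡⟨ y⇝w ⟩
    _                 ∎

  iter-preserves : ∀ {P : A → Set} → (∀ {x} → P x → P (f x)) → ∀ k {x} → P x → P (iter f k x)
  iter-preserves     step zero    px = px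
  iter-preserves {P} step (suc k) px = step (iter-preserves {P} step k px)

  -- zip (x ∷ xs) (xs ∷ʳ z) lists the steps of the path x → x₁ → ⋯ → z.
  path-reach : ∀ x xs z → (∀ {a b} → (a , b) ∈ zip (x ∷ xs) (xs ∷ʳ z) → f a ≡ b) →
               ∀ {y} → y ∈ x ∷ xs → (∃[ k ] iter f k x ≡ y) × EquivBy f y z
  path-reach x []        z follows (here refl) = (0 , refl) , (0 , follows (here refl))
  path-reach x (x₁ ∷ xs) z follows (here refl) with path-reach x₁ xs z (follows ∘ there) (here refl)
  ... | _ , (k , x₁⇝z) = (0 , refl) , (suc k , iter-∷ (suc k) (follows (here refl)) x₁⇝z)
  path-reach x (x₁ ∷ xs) z follows (there y∈) with path-reach x₁ xs z (follows ∘ there) y∈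
  ... | (k , x₁⇝y) , y⇝z = (suc k , iter-∷ k (follows (here refl)) x₁⇝y) , y⇝z

  cycle-EquivBy : ∀ (L : List A) → (∀ {a b} → (a , b) ∈ successorPairs L → f a ≡ b) →
                  ∀ {a b} → a ∈ L → b ∈ L → EquivBy f a b
  cycle-EquivBy (x ∷ xs) follows {a} {b} a∈ b∈
    with proj₂ (path-reach x xs x follows a∈) | proj₁ (path-reach x xs x follows b∈)
  ... | k , a⇝x | m , x⇝b = m + k , (begin
    iter f (suc (m + k)) a       ≡⟨ cong (λ i → iter f i a) (+-suc m k) ⟨
    iter f (m + suc k) a         ≡⟨ iter-+ m (suc k) a ⟩
    iter f m (iter f (suc k) a)  ≡⟨ cong (iter f m) a⇝x ⟩
    iter f m x                   ≡⟨ x⇝b ⟩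
    b                            ∎)

module _ {n : ℕ} where

  keys-succPairs : ∀ Cs → map proj₁ (succPairs {n} Cs) ≡ concatMap cycEdges Cs
  keys-succPairs Cs = trans (map-concatMap proj₁ (successorPairs ∘ cycEdges) Cs)
    (concatMap-cong (keys-successorPairs ∘ cycEdges) Cs)

  values-succPairs : ∀ Cs → map proj₂ (succPairs {n} Cs) ≡ concatMap (rotL ∘ cycEdges) Cs
  values-succPairs Cs = trans (map-concatMap proj₂ (successorPairs ∘ cycEdges) Cs)
    (concatMap-cong (values-successorPairs ∘ cycEdges) Cs)

  lookupSucc-∈ : ∀ ps {a b} → Unique (map proj₁ ps) → (a , b) ∈ ps → lookupSucc {n} ps a ≡ b
  lookupSucc-∈ ((a′ , _) ∷ ps) {a} (a′∉ ∷ uniq) ab∈ with a ≟E a′ | ab∈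
  ... | yes refl | here refl  = refl
  ... | yes refl | there ab∈′ = ⊥-elim (All.lookup a′∉ (∈-map⁺ proj₁ ab∈′) refl)
  ... | no a≢a′  | here refl  = ⊥-elim (a≢a′ refl)
  ... | no _     | there ab∈′ = lookupSucc-∈ ps uniq ab∈′

module DeltaC {n : ℕ} (Cs : List (List (Fin n))) (unique : Unique (concatMap cycEdges Cs)) where

  deltaC-on-cycle : ∀ {C a b} → C ∈ Cs → (a , b) ∈ successorPairs (cycEdges C) → deltaC Cs a ≡ b
  deltaC-on-cycle C∈ ab∈ =
    lookupSucc-∈ (succPairs Cs) (subst Unique (sym (keys-succPairs Cs)) unique)
      (∈-concatMap⁺ (successorPairs ∘ cycEdges) (lose C∈ ab∈))

  deltaC-cycle-closed : ∀ {C e} → C ∈ Cs → e ∈ cycEdges C → deltaC Cs e ∈ cycEdges C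
  deltaC-cycle-closed {C} C∈ e∈ with successor-exists e∈
  ... | _ , eb∈ = subst (_∈ cycEdges C) (sym (deltaC-on-cycle C∈ eb∈)) (proj₂ (∈-successorPairs⁻ eb∈))

  deltaC-graph : ∀ {e} → e ∈ concatMap cycEdges Cs → (e , deltaC Cs e) ∈ succPairs Cs
  deltaC-graph e∈ with find (∈-concatMap⁻ cycEdges {xs = Cs} e∈)
  ... | C , C∈ , e∈C with successor-exists e∈C
  ...   | _ , eb∈ rewrite deltaC-on-cycle C∈ eb∈ = ∈-concatMap⁺ (successorPairs ∘ cycEdges) (lose C∈ eb∈)

  deltaC-closed : ∀ {e} → e ∈ concatMap cycEdges Cs → deltaC Cs e ∈ concatMap cycEdges Cs
  deltaC-closed e∈ with find (∈-concatMap⁻ cycEdges {xs = Cs} e∈)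
  ... | C , C∈ , e∈C = ∈-concatMap⁺ cycEdges (lose C∈ (deltaC-cycle-closed C∈ e∈C))

  deltaC-injective : ∀ {e e′} → e ∈ concatMap cycEdges Cs → e′ ∈ concatMap cycEdges Cs →
                     deltaC Cs e ≡ deltaC Cs e′ → e ≡ e′
  deltaC-injective e∈ e′∈ eq = cong proj₁ (Unique-map-injective uniqueValues (deltaC-graph e∈) (deltaC-graph e′∈) eq)
    where
    uniqueValues : Unique (map proj₂ (succPairs Cs))
    uniqueValues = subst Unique (sym (values-succPairs Cs))
      (Unique-resp-↭ (↭-sym (concatMap-↭ (rotL-↭ ∘ cycEdges) Cs)) unique)

  deltaC-surjective : ∀ {e′} → e′ ∈ concatMap cycEdges Cs → ∃[ e ] (e ∈ concatMap cycEdges Cs × deltaC Cs e ≡ e′)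
  deltaC-surjective e′∈ with find (∈-concatMap⁻ cycEdges {xs = Cs} e′∈)
  ... | C , C∈ , e′∈C with predecessor-exists e′∈C
  ...   | e , ee′∈ = e , ∈-concatMap⁺ cycEdges (lose C∈ (proj₁ (∈-successorPairs⁻ ee′∈))) , deltaC-on-cycle C∈ ee′∈

  deltaC-orbits : ∀ {e e′} → e ∈ concatMap cycEdges Cs →
                  EquivBy (deltaC Cs) e e′ ⇔ Any (λ C → e ∈ cycEdges C × e′ ∈ cycEdges C) Cs
  deltaC-orbits {e} {e′} e∈ = mk⇔ to from
    where
    to : EquivBy (deltaC Cs) e e′ → Any (λ C → e ∈ cycEdges C × e′ ∈ cycEdges C) Cs
    to (k , e⇝e′) with find (∈-concatMap⁻ cycEdges {xs = Cs} e∈)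
    ... | C , C∈ , e∈C =
      lose C∈ (e∈C , subst (_∈ cycEdges C) e⇝e′
                     (iter-preserves (deltaC Cs) {_∈ cycEdges C} (deltaC-cycle-closed C∈) (suc k) e∈C))
    from : Any (λ C → e ∈ cycEdges C × e′ ∈ cycEdges C) Cs → EquivBy (deltaC Cs) e e′
    from same with find same
    ... | C , C∈ , e∈C , e′∈C = cycle-EquivBy (deltaC Cs) (cycEdges C) (deltaC-on-cycle C∈) e∈C e′∈C

module _ {n : ℕ} where

  written : State n → List (Edge n)
  written s = map pairOf (out s) ++ F s

  positionEdge : Pos n → Edge n
  positionEdge = map₂ proj₁

  pairs-finalOutput : ∀ s → map pairOf (finalOutput s) ≡ written s
  pairs-finalOutput s = trans (map-++ pairOf (out s) _)
    (cong (map pairOf (out s) ++_) (trans (sym (map-∘ (F s))) (map-id (F s))))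

  positions-↭ : ∀ vs → map positionEdge (positions {n} vs) ↭ cycEdges vs
  positions-↭ vs = begin
    map positionEdge (zip (rotR vs) (zip vs (rotL vs)))  ≡⟨ zip-map id proj₁ (rotR vs) (zip vs (rotL vs)) ⟨
    zip (map id (rotR vs)) (map proj₁ (zip vs (rotL vs))) ≡⟨ cong₂ zip (map-id (rotR vs)) (keys-successorPairs vs) ⟩
    zip (rotR vs) vs                                      ↭⟨ rotL-↭ (zip (rotR vs) vs) ⟨
    rotL (zip (rotR vs) vs)                               ≡⟨ rotL-zip (rotR vs) vs (length-rotR vs) ⟩
    zip (rotL (rotR vs)) (rotL vs)                        ≡⟨ cong (λ ws → zip ws (rotL vs)) (rotL-rotR vs) ⟩
    zip vs (rotL vs)                                      ∎
    where open PermutationReasoning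

  write-↭ : ∀ (o : List (Triple n)) t f → map pairOf (o ++ [ t ]) ++ f ↭ pairOf t ∷ map pairOf o ++ f
  write-↭ o t f = ↭-trans (↭-reflexive (cong (_++ f) (map-++ pairOf o [ t ]))) (∷ʳ-++-↭ (map pairOf o) (pairOf t) f)

  memE-sound : ∀ {e} es → memE {n} e es ≡ true → e ∈ es
  memE-sound {e} (x ∷ xs) found with e ≟E x
  ... | yes refl = here refl
  ... | no _     = there (memE-sound xs found)

  memE-complete : ∀ {e es} → e ∈ es → memE {n} e es ≡ true
  memE-complete {e} {x ∷ xs} e∈ with e ≟E x | e∈
  ... | yes _   | _          = refl
  ... | no e≢x  | here refl  = ⊥-elim (e≢x refl)
  ... | no _    | there e∈′ = memE-complete e∈′

  memE-written : ∀ {e} s → memE e (map pairOf (out s)) ∨ memE e (F s) ≡ true → e ∈ written s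
  memE-written {e} s found with memE e (map pairOf (out s)) in inOut
  ... | true  = ∈-++⁺ˡ (memE-sound (map pairOf (out s)) inOut)
  ... | false = ∈-++⁺ʳ _ (memE-sound (F s) found)

  written-step1-⊆ : ∀ P s → written (step1 P s) ⊆ map positionEdge P ++ written s
  written-step1-⊆ []              s = ⊆-refl
  written-step1-⊆ ((p , v , _) ∷ P) s with t s v ≡ᵇ 0
  ... | true  = ⊆-trans (written-step1-⊆ P _)
                  (++-∷-⊆ (map positionEdge P) (⊆-reflexive-↭ (++-∷ʳ-↭ (map pairOf (out s)) (F s) (p , v))))
  ... | false = ⊆-trans (written-step1-⊆ P s) (++-∷-⊆ (map positionEdge P) (xs⊆x∷xs _ _))

  ⊆-written-step1 : ∀ P s → written s ⊆ written (step1 P s)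
  ⊆-written-step1 []              s = ⊆-refl
  ⊆-written-step1 ((p , v , _) ∷ P) s with t s v ≡ᵇ 0
  ... | true  = ⊆-trans (xs⊆x∷xs _ _)
                  (⊆-trans (⊆-reflexive-↭ (↭-sym (++-∷ʳ-↭ (map pairOf (out s)) (F s) (p , v)))) (⊆-written-step1 P _))
  ... | false = ⊆-written-step1 P s

  written-step3-⊆ : ∀ J s → written (step3 J s) ⊆ map positionEdge J ++ written s
  written-step3-⊆ []              s = ⊆-refl
  written-step3-⊆ ((p , v , _) ∷ J) s =
    ⊆-trans (written-step3-⊆ J _) (++-∷-⊆ (map positionEdge J) (⊆-reflexive-↭ (write-↭ (out s) (p , v , j s v) (F s))))

  ⊆-written-step3 : ∀ J s → written s ⊆ written (step3 J s)
  ⊆-written-step3 []              s = ⊆-refl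
  ⊆-written-step3 ((p , v , _) ∷ J) s =
    ⊆-trans (xs⊆x∷xs _ _) (⊆-trans (⊆-reflexive-↭ (↭-sym (write-↭ (out s) (p , v , j s v) (F s)))) (⊆-written-step3 J _))

  written-step4-⊆ : ∀ P s → written (step4 P s) ⊆ map positionEdge P ++ written s
  written-step4-⊆ []              s = ⊆-refl
  written-step4-⊆ ((p , v , q) ∷ P) s with memE (p , v) (map pairOf (out s)) ∨ memE (p , v) (F s)
  ... | true  = ⊆-trans (written-step4-⊆ P s) (++-∷-⊆ (map positionEdge P) (xs⊆x∷xs _ _))
  ... | false = ⊆-trans (written-step4-⊆ P _)
                  (++-∷-⊆ (map positionEdge P) (⊆-reflexive-↭ (write-↭ (out s) (p , v , just q) (F s))))

  ⊆-written-step4 : ∀ P s → map positionEdge P ++ written s ⊆ written (step4 P s)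
  ⊆-written-step4 []              s = ⊆-refl
  ⊆-written-step4 ((p , v , q) ∷ P) s with memE (p , v) (map pairOf (out s)) ∨ memE (p , v) (F s) in found
  ... | true  = ⊆-trans (∷-++-⊆ (map positionEdge P) (∈-∷⁺ʳ (memE-written s found) ⊆-refl)) (⊆-written-step4 P s)
  ... | false = ⊆-trans (∷-++-⊆ (map positionEdge P) (⊆-reflexive-↭ (↭-sym (write-↭ (out s) (p , v , just q) (F s)))))
                  (⊆-written-step4 P _)

  written-step5 : ∀ M vs s → written (step5 {n} M vs s) ≡ written s
  written-step5 []      vs s = refl
  written-step5 (_ ∷ _) vs s = refl

  Eint-step1 : ∀ P s → Eint (step1 {n} P s) ≡ Eint s
  Eint-step1 []              s = refl
  Eint-step1 ((_ , v , _) ∷ P) s with t s v ≡ᵇ 0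
  ... | true  = Eint-step1 P _
  ... | false = Eint-step1 P s

  Eint-step3 : ∀ J s → Eint (step3 {n} J s) ≡ Eint s
  Eint-step3 []      s = refl
  Eint-step3 (_ ∷ J) s = Eint-step3 J _

  Eint-step4 : ∀ P s → Eint (step4 {n} P s) ≡ Eint s
  Eint-step4 []              s = refl
  Eint-step4 ((p , v , _) ∷ P) s with memE (p , v) (map pairOf (out s)) ∨ memE (p , v) (F s)
  ... | true  = Eint-step4 P s
  ... | false = Eint-step4 P _

  Eint-step5 : ∀ M vs s → Eint (step5 {n} M vs s) ≡ Eint s
  Eint-step5 []      vs s = refl
  Eint-step5 (_ ∷ _) vs s = refl

module _ {n : ℕ} (vs : List (Fin n)) (J : List (Pos n)) (s : State n) where
  private
    P  = positions vs
    Q  = map positionEdge P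
    s₁ = step1 P s
    s₃ = step3 J s₁
    s₄ = step4 P s₃

  written-mergeCycle-⊆ : All (_∈ P) J → written (mergeCycle vs J s) ⊆ written s ++ cycEdges vs
  written-mergeCycle-⊆ J⊆P = begin
    written (mergeCycle vs J s)               ≡⟨ written-step5 (Mset (t s) vs) vs s₄ ⟩
    written s₄                                ⊆⟨ written-step4-⊆ P s₃ ⟩
    Q ++ written s₃                           ⊆⟨ ++⁺ʳ Q (written-step3-⊆ J s₁) ⟩
    Q ++ map positionEdge J ++ written s₁     ⊆⟨ ++⁺ʳ Q (++⁺ʳ (map positionEdge J) (written-step1-⊆ P s)) ⟩
    Q ++ map positionEdge J ++ Q ++ written s ⊆⟨ ++-⊆ Q⊆ (++-⊆ J⊆ (++-⊆ Q⊆ (xs⊆xs++ys _ _))) ⟩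
    written s ++ cycEdges vs                  ∎
    where
    open ⊆-Reasoning (Edge n)
    Q⊆ : Q ⊆ written s ++ cycEdges vs
    Q⊆ = ⊆-trans (⊆-reflexive-↭ (positions-↭ vs)) (xs⊆ys++xs _ _)
    J⊆ : map positionEdge J ⊆ written s ++ cycEdges vs
    J⊆ = ⊆-trans (map⁺ positionEdge (All.lookup J⊆P)) Q⊆

  ⊆-written-mergeCycle : written s ++ cycEdges vs ⊆ written (mergeCycle vs J s)
  ⊆-written-mergeCycle = begin
    written s ++ cycEdges vs    ⊆⟨ ++-⊆ s⊆ (⊆-trans (⊆-reflexive-↭ (↭-sym (positions-↭ vs))) (xs⊆xs++ys Q _)) ⟩
    Q ++ written s₃             ⊆⟨ ⊆-written-step4 P s₃ ⟩
    written s₄                  ≡⟨ written-step5 (Mset (t s) vs) vs s₄ ⟨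
    written (mergeCycle vs J s) ∎
    where
    open ⊆-Reasoning (Edge n)
    s⊆ : written s ⊆ Q ++ written s₃
    s⊆ = ⊆-trans (⊆-written-step1 P s) (⊆-trans (⊆-written-step3 J s₁) (xs⊆ys++xs _ Q))

  Eint-mergeCycle : Eint (mergeCycle vs J s) ≡ Eint (step6 vs s)
  Eint-mergeCycle = cong (filter _) (begin
    Eint (step5 (Mset (t s) vs) vs s₄)  ≡⟨ Eint-step5 (Mset (t s) vs) vs s₄ ⟩
    Eint s₄                             ≡⟨ Eint-step4 P s₃ ⟩
    Eint s₃                             ≡⟨ Eint-step3 J s₁ ⟩
    Eint s₁                             ≡⟨ Eint-step1 P s ⟩
    Eint s                              ∎)
    where open ≡-Reasoning

module _ {n : ℕ} where

  written-Exec-⊆ : ∀ {s es Cs s′} → Exec {n} s es Cs s′ → written s′ ⊆ written s ++ concatMap cycEdges Cs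
  written-Exec-⊆ {s} done = xs⊆xs++ys (written s) []
  written-Exec-⊆ (noCycle _ run) = written-Exec-⊆ run
  written-Exec-⊆ {s} (merge {e = e} vs J _ (J⊆P , _) run) =
    ⊆-trans (written-Exec-⊆ run)
      (⊆-trans (++⁺ˡ _ (written-mergeCycle-⊆ vs J (addEdge e s) J⊆P)) (⊆-reflexive (++-assoc (written s) (cycEdges vs) _)))

  ⊆-written-Exec : ∀ {s es Cs s′} → Exec {n} s es Cs s′ → written s ++ concatMap cycEdges Cs ⊆ written s′
  ⊆-written-Exec {s} done = ⊆-reflexive (++-identityʳ (written s))
  ⊆-written-Exec (noCycle _ run) = ⊆-written-Exec run
  ⊆-written-Exec {s} (merge {e = e} vs J _ _ run) =
    ⊆-trans (⊆-reflexive (sym (++-assoc (written s) (cycEdges vs) _)))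
      (⊆-trans (++⁺ˡ _ (⊆-written-mergeCycle vs J (addEdge e s))) (⊆-written-Exec run))

  InRstar⇔cycleEdge : ∀ {es Cs s} → Exec initState es Cs s →
                      ∀ e → InRstar s e ⇔ e ∈ concatMap cycEdges Cs
  InRstar⇔cycleEdge {s = s} run e = mk⇔
    (λ e∈ → written-Exec-⊆ run (subst (e ∈_) (pairs-finalOutput s) e∈))
    (λ e∈ → subst (e ∈_) (sym (pairs-finalOutput s)) (⊆-written-Exec run e∈))

  _∉±_ : Edge n → List (Edge n) → Set
  d ∉± L = d ∉ L × swap d ∉ L

  ∉±-⊆ : ∀ {d L L′} → L′ ⊆ L → d ∉± L → d ∉± L′
  ∉±-⊆ L′⊆L (d∉ , d̃∉) = d∉ ∘ L′⊆L , d̃∉ ∘ L′⊆L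

  ∉±-++ : ∀ {d L L′} → d ∉± L → d ∉± L′ → d ∉± (L ++ L′)
  ∉±-++ {L = L} (d∉ , d̃∉) (d∉′ , d̃∉′) = [ d∉ , d∉′ ]′ ∘ ∈-++⁻ L , [ d̃∉ , d̃∉′ ]′ ∘ ∈-++⁻ L

  Adj-∉± : ∀ {d L} → Adj L (proj₁ d) (proj₂ d) → d ∉± L → ⊥
  Adj-∉± (inj₁ d∈) (d∉ , _) = d∉ d∈
  Adj-∉± (inj₂ d̃∈) (_ , d̃∉) = d̃∉ d̃∈

  head-∉± : ∀ {e es} → NoMultiEdges (e ∷ es) → e ∉± es
  head-∉± (e≉ ∷ _) = (λ e∈ → proj₁ (All.lookup e≉ e∈) refl) , (λ ẽ∈ → proj₂ (All.lookup e≉ ẽ∈) refl)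

  step6-∉± : ∀ {vs d} s → d ∈ cycEdges vs → d ∉± Eint (step6 vs s)
  step6-∉± {vs} {d} s d∈ =
      (λ kept → true≢false (trans (sym found) (∨-conicalˡ _ _ (proj₂ (∈-filter⁻ _ {xs = Eint s} kept)))))
    , (λ kept → true≢false (trans (sym found) (∨-conicalʳ _ _ (proj₂ (∈-filter⁻ _ {xs = Eint s} kept)))))
    where
    found : memE d (cycEdges vs) ≡ true
    found = memE-complete d∈
    true≢false : true ≢ false
    true≢false ()

  addEdge-fresh : ∀ {s e es} → NoMultiEdges (e ∷ es) → All (_∉± (e ∷ es)) (Eint s) → All (_∉± es) (Eint (addEdge e s))
  addEdge-fresh {e = e} {es} noMulti fresh = Allₚ.++⁺ (All.map (∉±-⊆ (xs⊆x∷xs es e)) fresh) (head-∉± noMulti ∷ [])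

  Adj-fresh : ∀ {d L es} → Adj L (proj₁ d) (proj₂ d) → All (_∉± es) L → d ∉± es
  Adj-fresh (inj₁ d∈) fresh = All.lookup fresh d∈
  Adj-fresh (inj₂ d̃∈) fresh = let d̃∉ , d∉ = All.lookup fresh d̃∈ in d∉ , d̃∉

  Unique-cycEdges : ∀ {vs : List (Fin n)} → Unique vs → Unique (cycEdges vs)
  Unique-cycEdges {vs} uvs = Unique.map⁻ (subst Unique (sym (keys-successorPairs vs)) uvs)

  -- R collects the edges of the cycles merged so far: they are gone, in both orientations,
  -- from E_int and from the rest of the stream, and E_int shares no undirected edge with it.
  cycles-unique : ∀ {s es Cs s′} → Exec {n} s es Cs s′ → NoMultiEdges es → All (_∉± es) (Eint s) →
                  ∀ {R} → Unique R → All (_∉± (Eint s ++ es)) R → Unique (concatMap cycEdges Cs ++ R)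
  cycles-unique done _ _ uR _ = uR
  cycles-unique {s} (noCycle {e = e} {es} _ run) noMulti fresh {R} uR retired =
    cycles-unique run (AllPairs.tail noMulti) (addEdge-fresh {s} noMulti fresh) uR
      (subst (λ L → All (_∉± L) R) (sym (++-assoc (Eint s) [ e ] es)) retired)
  cycles-unique {s} (merge {e = e} {es} {Cs} vs J (_ , uvs , adjacent) _ run) noMulti fresh {R} uR retired =
    Unique-resp-↭ (↭-trans (shifts (concatMap cycEdges Cs) (cycEdges vs))
                   (↭-reflexive (sym (++-assoc (cycEdges vs) (concatMap cycEdges Cs) R))))
      (cycles-unique run (AllPairs.tail noMulti) fresh₂ (Unique.++⁺ (Unique-cycEdges uvs) uR disjoint)
        (Allₚ.++⁺ (All.tabulate retiredNow) (All.map (∉±-⊆ (++⁺ˡ es Eint₂⊆Eint₁)) retired₁)))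
    where
    s₁ = addEdge e s
    s₂ = mergeCycle vs J s₁
    fresh₁ : All (_∉± es) (Eint s₁)
    fresh₁ = addEdge-fresh {s} noMulti fresh
    retired₁ : All (_∉± (Eint s₁ ++ es)) R
    retired₁ = subst (λ L → All (_∉± L) R) (sym (++-assoc (Eint s) [ e ] es)) retired
    Eint₂⊆Eint₁ : Eint s₂ ⊆ Eint s₁
    Eint₂⊆Eint₁ = ⊆-trans (⊆-reflexive (Eint-mergeCycle vs J s₁)) (filter-⊆ _ (Eint s₁))
    fresh₂ : All (_∉± es) (Eint s₂)
    fresh₂ = All-resp-⊇ Eint₂⊆Eint₁ fresh₁
    disjoint : Disjoint (cycEdges vs) R
    disjoint (d∈C , d∈R) = Adj-∉± (All.lookup adjacent d∈C) (∉±-⊆ (xs⊆xs++ys _ es) (All.lookup retired₁ d∈R))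
    retiredNow : ∀ {d} → d ∈ cycEdges vs → d ∉± (Eint s₂ ++ es)
    retiredNow {d} d∈ = ∉±-++ (subst (d ∉±_) (sym (Eint-mergeCycle vs J s₁)) (step6-∉± s₁ d∈))
                              (Adj-fresh (All.lookup adjacent d∈) fresh₁)

lemma5 : (n : ℕ) (es : List (Edge n)) →
         Loopless es → NoMultiEdges es → AllDegreesEven es →
         (Cs : List (List (Fin n))) (s : State n) →
         Exec initState es Cs s →
         ((e : Edge n) → InRstar s e → InRstar s (deltaC Cs e))
         × ((e e' : Edge n) → InRstar s e → InRstar s e' → deltaC Cs e ≡ deltaC Cs e' → e ≡ e')
         × ((e' : Edge n) → InRstar s e' → ∃[ e ] (InRstar s e × deltaC Cs e ≡ e'))
         × ((e e' : Edge n) → InRstar s e → InRstar s e' →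
            (EquivBy (deltaC Cs) e e' ⇔ Any (λ C → e ∈ cycEdges C × e' ∈ cycEdges C) Cs))
-- Loops and odd degrees are irrelevant here: excluding them only ensures that every edge of G
-- ends up on some C_i.
lemma5 n es _ noMulti _ Cs s run =
    (λ e e∈ → fromCycles (deltaC-closed (toCycles e∈)))
  , (λ e e′ e∈ e′∈ → deltaC-injective (toCycles e∈) (toCycles e′∈))
  , (λ e′ e′∈ → let e , e∈ , δe≡e′ = deltaC-surjective (toCycles e′∈) in e , fromCycles e∈ , δe≡e′)
  , (λ e e′ e∈ _ → deltaC-orbits (toCycles e∈))
  where
  unique : Unique (concatMap cycEdges Cs)
  unique = subst Unique (++-identityʳ _) (cycles-unique run noMulti [] [] [])
  toCycles : ∀ {e} → InRstar s e → e ∈ concatMap cycEdges Cs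
  toCycles = Equivalence.to (InRstar⇔cycleEdge run _)
  fromCycles : ∀ {e} → e ∈ concatMap cycEdges Cs → InRstar s e
  fromCycles = Equivalence.from (InRstar⇔cycleEdge run _)
  open DeltaC Cs unique
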